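{- Let $b_4$ be the infinite fixed point starting with $0$ of the morphism on $\{0,1,2,3\}$ given by $0\mapsto 01$, $1\mapsto 21$, $2\mapsto 03$, $3\mapsto 23$. Let $g_2$ and $g_3$ be the morphisms $g_2(0)=0000101001110110100$, $g_2(1)=0011100010100111101$, $g_2(2)=0000111100010110100$, $g_2(3)=0011110110100111101$; $g_3(0)=0010$, $g_3(1)=1122$, $g_3(2)=0200$, $g_3(3)=1212$. Then the infinite word $g_3(b_4)$ avoids every circular formula $C_i$ with $i\ge3$, and the infinite word $g_2(b_4)$ avoids every circular formula $C_i$ with $i\ge4$.
   Context: Variables are letters of an alphabet $\Delta$. A formula is a finite set of non-empty words over $\Delta$ (fragments). An occurrence of a formula $f$ in a word $w$ over $\Sigma$ is a non-erasing morphism $h:\Delta^*\to\Sigma^*$ such that $h(\phi)$ is a factor of $w$ for every fragment $\phi$ of $f$; $w$ avoids $f$ if it has no occurrence of $f$. For $t\ge1$, the circular formula $C_t$ is the formula over the variables $A_0,\dots,A_{t-1}$ whose fragments are the $t$ words $A_iA_{i+1}\cdots A_{i+t}$, $0\le i\le t-1$, indices modulo $t$. -}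

module Defs where

open import Data.Nat using (ℕ; zero; suc; _+_; _/_; NonZero)
open import Data.Nat.DivMod using (_mod_)
open import Data.Fin using (Fin; toℕ)
open import Data.List using (List; []; _∷_; map; concatMap; length; lookup; upTo; allFin)
open import Data.List.NonEmpty using (List⁺; _∷_; toList)
open import Data.List.Relation.Unary.All using (All)
open import Data.Vec using (Vec; []; _∷_) renaming (lookup to vlookup)
open import Data.Product using (Σ; ∃; _×_)
open import Relation.Binary.PropositionalEquality using (_≡_)
open import Relation.Nullary using (¬_)

Word∞ : Set → Set
Word∞ S = ℕ → S

IsFactor : {S : Set} → List S → Word∞ S → Set
IsFactor u w = ∃ λ (p : ℕ) → (j : Fin (length u)) → w (p + toℕ j) ≡ lookup u j

Formula : Set → Set
Formula Δ = List (List⁺ Δ)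

NonErasingMorphism : Set → Set → Set
NonErasingMorphism Δ S = Δ → List⁺ S

applyMorphism : {Δ S : Set} → NonErasingMorphism Δ S → List Δ → List S
applyMorphism h φ = concatMap (λ x → toList (h x)) φ

Occurs : {Δ S : Set} → Formula Δ → Word∞ S → Set
Occurs {Δ} {S} f w =
  Σ (NonErasingMorphism Δ S) λ h → All (λ φ → IsFactor (applyMorphism h (toList φ)) w) f

Avoids : {S : Set} → {Δ : Set} → Word∞ S → Formula Δ → Set
Avoids w f = ¬ Occurs f w

-- Circular formula C_t over A_0,…,A_{t-1} (t ≥ 1): fragments
-- A_i A_{i+1} ⋯ A_{i+t} (t+1 letters), 0 ≤ i ≤ t-1, indices mod t.
circularFragment : (t : ℕ) .{{_ : NonZero t}} → Fin t → List⁺ (Fin t)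
circularFragment t i = (toℕ i mod t) ∷ map (λ k → (toℕ i + suc k) mod t) (upTo t)

C : (t : ℕ) .{{_ : NonZero t}} → Formula (Fin t)
C t = map (circularFragment t) (allFin t)

σ : Fin 4 → List (Fin 4)
σ Fin.zero = Fin.zero ∷ Fin.suc Fin.zero ∷ []
σ (Fin.suc Fin.zero) = Fin.suc (Fin.suc Fin.zero) ∷ Fin.suc Fin.zero ∷ []
σ (Fin.suc (Fin.suc Fin.zero)) = Fin.zero ∷ Fin.suc (Fin.suc (Fin.suc Fin.zero)) ∷ []
σ (Fin.suc (Fin.suc (Fin.suc Fin.zero))) =
  Fin.suc (Fin.suc Fin.zero) ∷ Fin.suc (Fin.suc (Fin.suc Fin.zero)) ∷ []

σIter : ℕ → List (Fin 4)
σIter zero = Fin.zero ∷ []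
σIter (suc n) = concatMap σ (σIter n)

nthOr : {A : Set} → A → List A → ℕ → A
nthOr d [] _ = d
nthOr d (x ∷ _) zero = x
nthOr d (_ ∷ xs) (suc n) = nthOr d xs n

-- b₄ = lim σⁿ(0); position i is read in σ^{i+1}(0), which has length 2^{i+1} > i
-- (so the default is never used).
b4 : Word∞ (Fin 4)
b4 i = nthOr Fin.zero (σIter (suc i)) i

imageUniform : {A B : Set} {L : ℕ} → (A → Vec B (suc L)) → Word∞ A → Word∞ B
imageUniform {L = L} g w i = vlookup (g (w (i / suc L))) (i mod suc L)

private
  bits : {n : ℕ} → Vec ℕ n → Vec (Fin 2) n
  bits [] = []
  bits (zero ∷ xs) = Fin.zero ∷ bits xs
  bits (suc _ ∷ xs) = Fin.suc Fin.zero ∷ bits xs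

  tern : {n : ℕ} → Vec ℕ n → Vec (Fin 3) n
  tern [] = []
  tern (zero ∷ xs) = Fin.zero ∷ tern xs
  tern (suc zero ∷ xs) = Fin.suc Fin.zero ∷ tern xs
  tern (suc (suc _) ∷ xs) = Fin.suc (Fin.suc Fin.zero) ∷ tern xs

g2 : Fin 4 → Vec (Fin 2) 19
g2 Fin.zero = bits (0 ∷ 0 ∷ 0 ∷ 0 ∷ 1 ∷ 0 ∷ 1 ∷ 0 ∷ 0 ∷ 1 ∷ 1 ∷ 1 ∷ 0 ∷ 1 ∷ 1 ∷ 0 ∷ 1 ∷ 0 ∷ 0 ∷ [])
g2 (Fin.suc Fin.zero) = bits (0 ∷ 0 ∷ 1 ∷ 1 ∷ 1 ∷ 0 ∷ 0 ∷ 0 ∷ 1 ∷ 0 ∷ 1 ∷ 0 ∷ 0 ∷ 1 ∷ 1 ∷ 1 ∷ 1 ∷ 0 ∷ 1 ∷ [])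
g2 (Fin.suc (Fin.suc Fin.zero)) = bits (0 ∷ 0 ∷ 0 ∷ 0 ∷ 1 ∷ 1 ∷ 1 ∷ 1 ∷ 0 ∷ 0 ∷ 0 ∷ 1 ∷ 0 ∷ 1 ∷ 1 ∷ 0 ∷ 1 ∷ 0 ∷ 0 ∷ [])
g2 (Fin.suc (Fin.suc (Fin.suc Fin.zero))) = bits (0 ∷ 0 ∷ 1 ∷ 1 ∷ 1 ∷ 1 ∷ 0 ∷ 1 ∷ 1 ∷ 0 ∷ 1 ∷ 0 ∷ 0 ∷ 1 ∷ 1 ∷ 1 ∷ 1 ∷ 0 ∷ 1 ∷ [])

g3 : Fin 4 → Vec (Fin 3) 4
g3 Fin.zero = tern (0 ∷ 0 ∷ 1 ∷ 0 ∷ [])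
g3 (Fin.suc Fin.zero) = tern (1 ∷ 1 ∷ 2 ∷ 2 ∷ [])
g3 (Fin.suc (Fin.suc Fin.zero)) = tern (0 ∷ 2 ∷ 0 ∷ 0 ∷ [])
g3 (Fin.suc (Fin.suc (Fin.suc Fin.zero))) = tern (1 ∷ 2 ∷ 1 ∷ 2 ∷ [])

{-# OPTIONS --safe #-}
-- An occurrence h of C_t in w yields a cycle of period p = |h(A₀ ⋯ A_{t−1})| ≥ t in w:
-- every factor of length p + 1 of the periodic word (h(A₀) ⋯ h(A_{t−1}))^ω is a factor of w.
-- The fixed point b4 has no cycle at all. A letter of b4 consists of the parity of its
-- position and one more bit; hence a cycle of period q in b4 has q even and splits into
-- σ-images, giving a cycle of period q/2; descent on q concludes.
-- For x = g(b4) with g uniform of length L, factors of a fixed length D determine the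
-- position modulo L, so a cycle of period p ≥ D has L ∣ p; since letters of b4 are
-- recognised from a prefix and from a suffix of their images, it desubstitutes to a cycle
-- of period p/L in b4. The periods below D, and all the finite conditions on g, are
-- checked by evaluation.

module Submission where

open import Defs
open import Data.Nat
open import Data.Nat.Properties
open import Data.Nat.DivMod
open import Data.Nat.Divisibility using (m∣m*n; n∣m*n)
open import Data.Nat.Induction using (<-rec)
open import Data.Nat.Tactic.RingSolver using (solve-∀)
open import Data.Fin using (Fin; toℕ; fromℕ<) renaming (zero to fz; suc to fs)
import Data.Fin.Properties as Fin
open import Data.List using (List; []; _∷_; _++_; length; concatMap; map; upTo; applyUpTo; lookup)
import Data.List.Properties as List
open import Data.List.NonEmpty using (List⁺; _∷_; toList; head)
open import Data.List.Relation.Unary.All using (All; []; _∷_)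
import Data.List.Relation.Unary.All as All
open import Data.List.Relation.Unary.All.Properties using (map⁻; applyUpTo⁻)
open import Data.List.Membership.Propositional.Properties using (∈-allFin)
open import Data.Parity using (Parity; 0ℙ; 1ℙ; _⁻¹) renaming (_+_ to _⊕_)
import Data.Parity.Properties as Parity
open import Data.Product using (Σ; ∃; ∃₂; _×_; _,_; proj₁; proj₂)
open import Data.Sum using (_⊎_; inj₁; inj₂)
open import Data.Vec using (Vec) renaming (lookup to vlookup)
open import Function using (_∘_)
open import Relation.Binary.Definitions using (DecidableEquality)
open import Relation.Binary.PropositionalEquality
open import Relation.Nullary using (¬_; Dec; yes; no; ¬?; _→-dec_)
open import Relation.Nullary.Decidable using (from-yes)

-- Cycles and circular formulas

record Cycle {A : Set} (x : Word∞ A) (p : ℕ) : Set where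
  field
    word     : ℕ → A
    periodic : ∀ n → word (n + p) ≡ word n
    position : ℕ → ℕ
    window   : ∀ j i → i ≤ p → x (position j + i) ≡ word (j + i)

  window₀ : ∀ j → x (position j) ≡ word j
  window₀ j = trans (cong x (sym (+-identityʳ _))) (trans (window j 0 z≤n) (cong word (+-identityʳ j)))

  periodic* : ∀ n k → word (n + k * p) ≡ word n
  periodic* n zero = cong word (+-identityʳ n)
  periodic* n (suc k) = begin
    word (n + (p + k * p))  ≡⟨ cong word (trans (cong (n +_) (+-comm p (k * p))) (sym (+-assoc n (k * p) p))) ⟩
    word (n + k * p + p)    ≡⟨ periodic (n + k * p) ⟩
    word (n + k * p)        ≡⟨ periodic* n k ⟩
    word n                  ∎
    where open ≡-Reasoning

shiftCycle : ∀ {A} {x : Word∞ A} {p} → ℕ → Cycle x p → Cycle x p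
shiftCycle {p = p} s c = record
  { word = λ n → word (s + n)
  ; periodic = λ n → trans (cong word (sym (+-assoc s n p))) (periodic (s + n))
  ; position = λ j → position (s + j)
  ; window = λ j i i≤p → trans (window (s + j) i i≤p) (cong word (+-assoc s j i))
  }
  where open Cycle c

module _ {A : Set} (d : A) where

  nthOr-++ˡ : ∀ xs ys {i} → i < length xs → nthOr d (xs ++ ys) i ≡ nthOr d xs i
  nthOr-++ˡ (x ∷ xs) ys {zero} _ = refl
  nthOr-++ˡ (x ∷ xs) ys {suc i} (s≤s i<n) = nthOr-++ˡ xs ys i<n

  nthOr-++ʳ : ∀ xs ys i → nthOr d (xs ++ ys) (length xs + i) ≡ nthOr d ys i
  nthOr-++ʳ [] ys i = refl
  nthOr-++ʳ (x ∷ xs) ys i = nthOr-++ʳ xs ys i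

  lookup≡nthOr : ∀ xs (i : Fin (length xs)) → lookup xs i ≡ nthOr d xs (toℕ i)
  lookup≡nthOr (x ∷ xs) fz = refl
  lookup≡nthOr (x ∷ xs) (fs i) = lookup≡nthOr xs i

  isFactor⇒nthOr : ∀ u {w} → IsFactor u w → ∃ λ q → ∀ r → r < length u → w (q + r) ≡ nthOr d u r
  isFactor⇒nthOr u {w} (q , occ) = q , λ r r<n → begin
    w (q + r)                     ≡⟨ cong (w ∘ (q +_)) (sym (Fin.toℕ-fromℕ< r<n)) ⟩
    w (q + toℕ (fromℕ< r<n))      ≡⟨ occ (fromℕ< r<n) ⟩
    lookup u (fromℕ< r<n)         ≡⟨ lookup≡nthOr u (fromℕ< r<n) ⟩
    nthOr d u (toℕ (fromℕ< r<n))  ≡⟨ cong (nthOr d u) (Fin.toℕ-fromℕ< r<n) ⟩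
    nthOr d u r                   ∎
    where open ≡-Reasoning

module CircularOccurrence {S : Set} {t′ : ℕ} (h : Fin (suc t′) → List⁺ S) where

  t : ℕ
  t = suc t′

  default : S
  default = head (h fz)

  image : ℕ → List S
  image e = toList (h (e mod t))

  blocks : ℕ → ℕ → List S
  blocks e zero = []
  blocks e (suc n) = image e ++ blocks (suc e) n

  p : ℕ
  p = length (blocks 0 t)

  cyclicWord : ℕ → S
  cyclicWord n = nthOr default (blocks 0 (suc n)) n

  1≤length-image : ∀ e → 1 ≤ length (image e)
  1≤length-image e with h (e mod t)
  ... | _ ∷ _ = s≤s z≤n

  n≤length-blocks : ∀ e n → n ≤ length (blocks e n)
  n≤length-blocks e zero = z≤n
  n≤length-blocks e (suc n) = begin
    1 + n                                         ≤⟨ +-mono-≤ (1≤length-image e) (n≤length-blocks (suc e) n) ⟩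
    length (image e) + length (blocks (suc e) n)  ≡⟨ List.length-++ (image e) ⟨
    length (blocks e (suc n))                     ∎
    where open ≤-Reasoning

  blocks-+ : ∀ e m n → blocks e (m + n) ≡ blocks e m ++ blocks (e + m) n
  blocks-+ e zero n = cong (λ e′ → blocks e′ n) (sym (+-identityʳ e))
  blocks-+ e (suc m) n = begin
    image e ++ blocks (suc e) (m + n)                      ≡⟨ cong (image e ++_) (blocks-+ (suc e) m n) ⟩
    image e ++ (blocks (suc e) m ++ blocks (suc e + m) n)  ≡⟨ List.++-assoc (image e) _ _ ⟨
    (image e ++ blocks (suc e) m) ++ blocks (suc e + m) n  ≡⟨ cong (λ e′ → blocks e (suc m) ++ blocks e′ n) (sym (+-suc e m)) ⟩
    blocks e (suc m) ++ blocks (e + suc m) n               ∎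
    where open ≡-Reasoning

  blocks-periodic : ∀ e n → blocks (e + t) n ≡ blocks e n
  blocks-periodic e zero = refl
  blocks-periodic e (suc n) = cong₂ _++_ (cong (toList ∘ h) mod-periodic) (blocks-periodic (suc e) n)
    where
    mod-periodic : (e + t) mod t ≡ e mod t
    mod-periodic = Fin.toℕ-injective (begin
      toℕ ((e + t) mod t)  ≡⟨ Fin.toℕ-fromℕ< _ ⟩
      (e + t) % t          ≡⟨ [m+n]%n≡m%n e t ⟩
      e % t                ≡⟨ Fin.toℕ-fromℕ< _ ⟨
      toℕ (e mod t)        ∎)
      where open ≡-Reasoning

  blocks-periodic* : ∀ e k n → blocks (e + k * t) n ≡ blocks e n
  blocks-periodic* e zero n = cong (λ e′ → blocks e′ n) (+-identityʳ e)
  blocks-periodic* e (suc k) n = begin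
    blocks (e + (t + k * t)) n  ≡⟨ cong (λ e′ → blocks e′ n) (trans (cong (e +_) (+-comm t (k * t))) (sym (+-assoc e (k * t) t))) ⟩
    blocks (e + k * t + t) n    ≡⟨ blocks-periodic (e + k * t) n ⟩
    blocks (e + k * t) n        ≡⟨ blocks-periodic* e k n ⟩
    blocks e n                  ∎
    where open ≡-Reasoning

  blocks-mod : ∀ e n → blocks (toℕ (e mod t)) n ≡ blocks e n
  blocks-mod e n = begin
    blocks (toℕ (e mod t)) n              ≡⟨ blocks-periodic* (toℕ (e mod t)) (e / t) n ⟨
    blocks (toℕ (e mod t) + e / t * t) n  ≡⟨ cong (λ r → blocks (r + e / t * t) n) (Fin.toℕ-fromℕ< _) ⟩
    blocks (e % t + e / t * t) n          ≡⟨ cong (λ e′ → blocks e′ n) (m≡m%n+[m/n]*n e t) ⟨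
    blocks e n                            ∎
    where open ≡-Reasoning

  length-blocks-period : ∀ e → length (blocks e t) ≡ p
  length-blocks-period e = +-cancelˡ-≡ (length (blocks 0 e)) _ _ (begin
    length (blocks 0 e) + length (blocks e t)  ≡⟨ List.length-++ (blocks 0 e) ⟨
    length (blocks 0 e ++ blocks e t)          ≡⟨ cong length (blocks-+ 0 e t) ⟨
    length (blocks 0 (e + t))                  ≡⟨ cong (λ n → length (blocks 0 n)) (+-comm e t) ⟩
    length (blocks 0 (t + e))                  ≡⟨ cong length (blocks-+ 0 t e) ⟩
    length (blocks 0 t ++ blocks t e)          ≡⟨ List.length-++ (blocks 0 t) ⟩
    p + length (blocks t e)                    ≡⟨ cong (λ bs → p + length bs) (blocks-periodic 0 e) ⟩
    p + length (blocks 0 e)                    ≡⟨ +-comm p _ ⟩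
    length (blocks 0 e) + p                    ∎)
    where open ≡-Reasoning

  nthOr-blocks-extend : ∀ e m n {r} → r < length (blocks e m) →
                        nthOr default (blocks e (m + n)) r ≡ nthOr default (blocks e m) r
  nthOr-blocks-extend e m n {r} r<n = trans (cong (λ bs → nthOr default bs r) (blocks-+ e m n)) (nthOr-++ˡ default (blocks e m) (blocks (e + m) n) r<n)

  nthOr-blocks-irrelevant : ∀ e m n {r} → r < length (blocks e m) → r < length (blocks e n) →
                            nthOr default (blocks e m) r ≡ nthOr default (blocks e n) r
  nthOr-blocks-irrelevant e m n r<m r<n with ≤-total m n
  ... | inj₁ m≤n = trans (sym (nthOr-blocks-extend e m (n ∸ m) r<m)) (cong (λ k → nthOr default (blocks e k) _) (m+[n∸m]≡n m≤n))
  ... | inj₂ n≤m = trans (cong (λ k → nthOr default (blocks e k) _) (sym (m+[n∸m]≡n n≤m))) (nthOr-blocks-extend e n (m ∸ n) r<n)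

  cyclicWord-blocks : ∀ e n {r} → r < length (blocks e n) → cyclicWord (length (blocks 0 e) + r) ≡ nthOr default (blocks e n) r
  cyclicWord-blocks e n {r} r<n = begin
    cyclicWord k                                ≡⟨ nthOr-blocks-irrelevant 0 (suc k) (e + n) (n≤length-blocks 0 (suc k)) k<en ⟩
    nthOr default (blocks 0 (e + n)) k          ≡⟨ cong (λ bs → nthOr default bs k) (blocks-+ 0 e n) ⟩
    nthOr default (blocks 0 e ++ blocks e n) k  ≡⟨ nthOr-++ʳ default (blocks 0 e) (blocks e n) r ⟩
    nthOr default (blocks e n) r                ∎
    where
    open ≡-Reasoning
    k = length (blocks 0 e) + r
    k<en : k < length (blocks 0 (e + n))
    k<en = subst (k <_) (trans (sym (List.length-++ (blocks 0 e))) (cong length (sym (blocks-+ 0 e n))))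
                 (+-monoʳ-< (length (blocks 0 e)) r<n)

  cyclicWord-periodic : ∀ n → cyclicWord (n + p) ≡ cyclicWord n
  cyclicWord-periodic n = begin
    cyclicWord (n + p)                        ≡⟨ cong cyclicWord (+-comm n p) ⟩
    cyclicWord (p + n)                        ≡⟨ cyclicWord-blocks t (suc n) (n≤length-blocks t (suc n)) ⟩
    nthOr default (blocks (0 + t) (suc n)) n  ≡⟨ cong (λ bs → nthOr default bs n) (blocks-periodic 0 (suc n)) ⟩
    cyclicWord n                              ∎
    where open ≡-Reasoning

  length-blocks-suc : ∀ e → length (blocks 0 (suc e)) ≡ length (blocks 0 e) + length (image e)
  length-blocks-suc e = begin
    length (blocks 0 (suc e))                     ≡⟨ cong (λ n → length (blocks 0 n)) (+-comm 1 e) ⟩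
    length (blocks 0 (e + 1))                     ≡⟨ cong length (blocks-+ 0 e 1) ⟩
    length (blocks 0 e ++ image e ++ [])          ≡⟨ List.length-++ (blocks 0 e) ⟩
    length (blocks 0 e) + length (image e ++ [])  ≡⟨ cong (λ bs → length (blocks 0 e) + length bs) (List.++-identityʳ (image e)) ⟩
    length (blocks 0 e) + length (image e)        ∎
    where open ≡-Reasoning

  locate : ∀ j → ∃₂ λ e r → j ≡ length (blocks 0 e) + r × r < length (image e)
  locate zero = 0 , 0 , refl , 1≤length-image 0
  locate (suc j) with locate j
  ... | e , r , j≡ , r<ℓ with suc r <? length (image e)
  ...   | yes r+1<ℓ = e , suc r , trans (cong suc j≡) (sym (+-suc _ r)) , r+1<ℓ
  ...   | no r+1≮ℓ = suc e , 0 , (begin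
          suc j                                   ≡⟨ cong suc j≡ ⟩
          suc (length (blocks 0 e) + r)           ≡⟨ +-suc _ r ⟨
          length (blocks 0 e) + suc r             ≡⟨ cong (length (blocks 0 e) +_) (≤-antisym r<ℓ (≮⇒≥ r+1≮ℓ)) ⟩
          length (blocks 0 e) + length (image e)  ≡⟨ length-blocks-suc e ⟨
          length (blocks 0 (suc e))               ≡⟨ +-identityʳ _ ⟨
          length (blocks 0 (suc e)) + 0           ∎) , 1≤length-image (suc e)
    where open ≡-Reasoning

  fragment≡blocks : ∀ (i : Fin t) → applyMorphism h (toList (circularFragment t i)) ≡ blocks (toℕ i) (suc t)
  fragment≡blocks i = cong (image (toℕ i) ++_) (begin
    concatMap (toList ∘ h) (map (λ k → (toℕ i + suc k) mod t) (upTo t))  ≡⟨ cong (concatMap (toList ∘ h)) (List.map-upTo _ t) ⟩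
    concatMap (toList ∘ h) (applyUpTo (λ k → (toℕ i + suc k) mod t) t)   ≡⟨ applyUpTo-blocks _ (suc (toℕ i)) t (λ k → cong (_mod t) (+-suc (toℕ i) k)) ⟩
    blocks (suc (toℕ i)) t                                               ∎)
    where
    open ≡-Reasoning
    applyUpTo-blocks : ∀ f e n → (∀ k → f k ≡ (e + k) mod t) → concatMap (toList ∘ h) (applyUpTo f n) ≡ blocks e n
    applyUpTo-blocks f e zero f≗ = refl
    applyUpTo-blocks f e (suc n) f≗ = cong₂ _++_ (cong (toList ∘ h) (trans (f≗ 0) (cong (_mod t) (+-identityʳ e))))
                                                  (applyUpTo-blocks (f ∘ suc) (suc e) n (λ k → trans (f≗ (suc k)) (cong (_mod t) (+-suc e k))))

  length-blocks-fragment : ∀ e → length (blocks e (suc t)) ≡ length (image e) + p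
  length-blocks-fragment e = trans (List.length-++ (image e)) (cong (length (image e) +_) (length-blocks-period (suc e)))

  occurrence⇒Cycle : ∀ {w : Word∞ S} → (∀ (i : Fin t) → IsFactor (applyMorphism h (toList (circularFragment t i))) w) → Cycle w p
  occurrence⇒Cycle {w} occ = record { word = cyclicWord ; periodic = cyclicWord-periodic ; position = position ; window = window }
    where
    fragment-at : ∀ e → ∃ λ q → ∀ r → r < length (blocks e (suc t)) → w (q + r) ≡ nthOr default (blocks e (suc t)) r
    fragment-at e = subst (λ u → ∃ λ q → ∀ r → r < length u → w (q + r) ≡ nthOr default u r)
                          (trans (fragment≡blocks (e mod t)) (blocks-mod e (suc t)))
                          (isFactor⇒nthOr default _ {w} (occ (e mod t)))
    position : ℕ → ℕ
    position j with locate j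
    ... | e , r , _ = proj₁ (fragment-at e) + r
    window : ∀ j i → i ≤ p → w (position j + i) ≡ cyclicWord (j + i)
    window j i i≤p with locate j
    ... | e , r , refl , r<ℓ = begin
      w (q + r + i)                               ≡⟨ cong w (+-assoc q r i) ⟩
      w (q + (r + i))                             ≡⟨ proj₂ (fragment-at e) (r + i) r+i<n ⟩
      nthOr default (blocks e (suc t)) (r + i)    ≡⟨ cyclicWord-blocks e (suc t) r+i<n ⟨
      cyclicWord (length (blocks 0 e) + (r + i))  ≡⟨ cong cyclicWord (+-assoc (length (blocks 0 e)) r i) ⟨
      cyclicWord (length (blocks 0 e) + r + i)    ∎
      where
      open ≡-Reasoning
      q = proj₁ (fragment-at e)
      r+i<n : r + i < length (blocks e (suc t))
      r+i<n = subst (r + i <_) (sym (length-blocks-fragment e)) (+-mono-<-≤ r<ℓ i≤p)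

  t≤p : t ≤ p
  t≤p = n≤length-blocks 0 t

occurs-C⇒Cycle : ∀ {S : Set} {w : Word∞ S} t′ → Occurs (C (suc t′)) w → ∃ λ p → suc t′ ≤ p × Cycle w p
occurs-C⇒Cycle t′ (h , occ) = p , t≤p , occurrence⇒Cycle (λ i → All.lookup (map⁻ occ) (∈-allFin i))
  where open CircularOccurrence h

-- The fixed point b4

lo hi : Fin 4 → Parity
lo fz = 0ℙ
lo (fs fz) = 1ℙ
lo (fs (fs fz)) = 0ℙ
lo (fs (fs (fs fz))) = 1ℙ
hi fz = 0ℙ
hi (fs fz) = 0ℙ
hi (fs (fs fz)) = 1ℙ
hi (fs (fs (fs fz))) = 1ℙ

fromBits : Parity → Parity → Fin 4
fromBits 0ℙ 0ℙ = fz
fromBits 1ℙ 0ℙ = fs fz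
fromBits 0ℙ 1ℙ = fs (fs fz)
fromBits 1ℙ 1ℙ = fs (fs (fs fz))

lo-fromBits : ∀ a b → lo (fromBits a b) ≡ a
lo-fromBits 0ℙ 0ℙ = refl
lo-fromBits 1ℙ 0ℙ = refl
lo-fromBits 0ℙ 1ℙ = refl
lo-fromBits 1ℙ 1ℙ = refl

hi-fromBits : ∀ a b → hi (fromBits a b) ≡ b
hi-fromBits 0ℙ 0ℙ = refl
hi-fromBits 1ℙ 0ℙ = refl
hi-fromBits 0ℙ 1ℙ = refl
hi-fromBits 1ℙ 1ℙ = refl

lo-hi-injective : ∀ {a b} → lo a ≡ lo b → hi a ≡ hi b → a ≡ b
lo-hi-injective {a} {b} lo≡ hi≡ = begin
  a                       ≡⟨ fromBits-lo-hi a ⟨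
  fromBits (lo a) (hi a)  ≡⟨ cong₂ fromBits lo≡ hi≡ ⟩
  fromBits (lo b) (hi b)  ≡⟨ fromBits-lo-hi b ⟩
  b                       ∎
  where
  open ≡-Reasoning
  fromBits-lo-hi : ∀ a → fromBits (lo a) (hi a) ≡ a
  fromBits-lo-hi fz = refl
  fromBits-lo-hi (fs fz) = refl
  fromBits-lo-hi (fs (fs fz)) = refl
  fromBits-lo-hi (fs (fs (fs fz))) = refl

σ₀ σ₁ : Fin 4 → Fin 4
σ₀ a = fromBits 0ℙ (lo a)
σ₁ a = fromBits 1ℙ (hi a)

σ≡σ₀σ₁ : ∀ a → σ a ≡ σ₀ a ∷ σ₁ a ∷ []
σ≡σ₀σ₁ fz = refl
σ≡σ₀σ₁ (fs fz) = refl
σ≡σ₀σ₁ (fs (fs fz)) = refl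
σ≡σ₀σ₁ (fs (fs (fs fz))) = refl

length-concatMap-σ : ∀ xs → length (concatMap σ xs) ≡ length xs + length xs
length-concatMap-σ [] = refl
length-concatMap-σ (x ∷ xs) rewrite σ≡σ₀σ₁ x | length-concatMap-σ xs = cong suc (sym (+-suc (length xs) (length xs)))

nthOr-concatMap-σ₀ : ∀ xs {k} → k < length xs → nthOr fz (concatMap σ xs) (k + k) ≡ σ₀ (nthOr fz xs k)
nthOr-concatMap-σ₀ (x ∷ xs) {zero} _ rewrite σ≡σ₀σ₁ x = refl
nthOr-concatMap-σ₀ (x ∷ xs) {suc k} (s≤s k<n) rewrite σ≡σ₀σ₁ x | +-suc k k = nthOr-concatMap-σ₀ xs k<n

nthOr-concatMap-σ₁ : ∀ xs {k} → k < length xs → nthOr fz (concatMap σ xs) (suc (k + k)) ≡ σ₁ (nthOr fz xs k)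
nthOr-concatMap-σ₁ (x ∷ xs) {zero} _ rewrite σ≡σ₀σ₁ x = refl
nthOr-concatMap-σ₁ (x ∷ xs) {suc k} (s≤s k<n) rewrite σ≡σ₀σ₁ x | +-suc k k = nthOr-concatMap-σ₁ xs k<n

σIter-extends : ∀ n → ∃ λ zs → σIter (suc n) ≡ σIter n ++ zs
σIter-extends zero = fs fz ∷ [] , refl
σIter-extends (suc n) with σIter-extends n
... | zs , eq = concatMap σ zs , trans (cong (concatMap σ) eq) (List.concatMap-++ σ (σIter n) zs)

n<length-σIter : ∀ n → n < length (σIter n)
n<length-σIter zero = s≤s z≤n
n<length-σIter (suc n) = begin
  suc (suc n)                          ≤⟨ s≤s (m≤n+m (suc n) n) ⟩
  suc n + suc n                        ≤⟨ +-mono-≤ (n<length-σIter n) (n<length-σIter n) ⟩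
  length (σIter n) + length (σIter n)  ≡⟨ length-concatMap-σ (σIter n) ⟨
  length (σIter (suc n))               ∎
  where open ≤-Reasoning

nthOr-σIter-stable : ∀ k n {i} → i < length (σIter n) → nthOr fz (σIter (k + n)) i ≡ nthOr fz (σIter n) i
nthOr-σIter-stable zero n _ = refl
nthOr-σIter-stable (suc k) n {i} i<n with σIter-extends (k + n)
... | zs , eq = begin
  nthOr fz (σIter (suc k + n)) i    ≡⟨ cong (λ xs → nthOr fz xs i) eq ⟩
  nthOr fz (σIter (k + n) ++ zs) i  ≡⟨ nthOr-++ˡ fz (σIter (k + n)) zs (<-≤-trans i<n (length-mono k)) ⟩
  nthOr fz (σIter (k + n)) i        ≡⟨ nthOr-σIter-stable k n i<n ⟩
  nthOr fz (σIter n) i              ∎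
  where
  open ≡-Reasoning
  length-mono : ∀ k → length (σIter n) ≤ length (σIter (k + n))
  length-mono zero = ≤-refl
  length-mono (suc k) = ≤-trans (length-mono k) (≤-trans (m≤m+n ℓ ℓ) (≤-reflexive (sym (length-concatMap-σ (σIter (k + n))))))
    where ℓ = length (σIter (k + n))

nthOr-σIter≡b4 : ∀ n {i} → i < length (σIter n) → nthOr fz (σIter n) i ≡ b4 i
nthOr-σIter≡b4 n {i} i<n with ≤-total n (suc i)
... | inj₁ n≤ = trans (sym (nthOr-σIter-stable (suc i ∸ n) n i<n)) (cong (λ m → nthOr fz (σIter m) i) (m∸n+n≡m n≤))
... | inj₂ ≤n = trans (cong (λ m → nthOr fz (σIter m) i) (sym (m∸n+n≡m ≤n)))
                      (nthOr-σIter-stable (n ∸ suc i) (suc i) (<⇒≤ (n<length-σIter (suc i))))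

b4-double : ∀ k → b4 (k + k) ≡ σ₀ (b4 k)
b4-double k = begin
  b4 (k + k)                                      ≡⟨ nthOr-σIter≡b4 (2 + k) k+k<n ⟨
  nthOr fz (concatMap σ (σIter (suc k))) (k + k)  ≡⟨ nthOr-concatMap-σ₀ (σIter (suc k)) k<n ⟩
  σ₀ (nthOr fz (σIter (suc k)) k)                 ≡⟨ cong σ₀ (nthOr-σIter≡b4 (suc k) k<n) ⟩
  σ₀ (b4 k)                                       ∎
  where
  open ≡-Reasoning
  k<n : k < length (σIter (suc k))
  k<n = <⇒≤ (n<length-σIter (suc k))
  k+k<n : k + k < length (σIter (2 + k))
  k+k<n = subst (k + k <_) (sym (length-concatMap-σ (σIter (suc k)))) (+-mono-≤-< (<⇒≤ k<n) k<n)

b4-double+1 : ∀ k → b4 (suc (k + k)) ≡ σ₁ (b4 k)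
b4-double+1 k = begin
  b4 (suc (k + k))                                      ≡⟨ nthOr-σIter≡b4 (2 + k) k+k<n ⟨
  nthOr fz (concatMap σ (σIter (suc k))) (suc (k + k))  ≡⟨ nthOr-concatMap-σ₁ (σIter (suc k)) k<n ⟩
  σ₁ (nthOr fz (σIter (suc k)) k)                       ≡⟨ cong σ₁ (nthOr-σIter≡b4 (suc k) k<n) ⟩
  σ₁ (b4 k)                                             ∎
  where
  open ≡-Reasoning
  k<n : k < length (σIter (suc k))
  k<n = <⇒≤ (n<length-σIter (suc k))
  k+k<n : suc (k + k) < length (σIter (2 + k))
  k+k<n = subst (suc (k + k) <_) (sym (length-concatMap-σ (σIter (suc k))))
                (subst (_≤ length (σIter (suc k)) + length (σIter (suc k))) (+-suc (suc k) k) (+-mono-≤ k<n k<n))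

parity-double : ∀ k → parity (k + k) ≡ 0ℙ
parity-double k = trans (Parity.+-homo-+ k k) (Parity.p+p≡0ℙ (parity k))

parity-double+1 : ∀ k → parity (suc (k + k)) ≡ 1ℙ
parity-double+1 k = trans (Parity.+-homo-+ 1 (k + k)) (cong (1ℙ ⊕_) (parity-double k))

halve : ∀ n → ∃ λ k → n ≡ k + k ⊎ n ≡ suc (k + k)
halve zero = 0 , inj₁ refl
halve (suc n) with halve n
... | k , inj₁ n≡ = k , inj₂ (cong suc n≡)
... | k , inj₂ n≡ = suc k , inj₁ (trans (cong suc n≡) (cong suc (sym (+-suc k k))))

even⇒double : ∀ n → parity n ≡ 0ℙ → ∃ λ k → n ≡ k + k
even⇒double n even with halve n
... | k , inj₁ n≡ = k , n≡
... | k , inj₂ refl with () ← trans (sym (parity-double+1 k)) even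

odd⇒double+1 : ∀ n → parity n ≡ 1ℙ → ∃ λ k → n ≡ suc (k + k)
odd⇒double+1 n odd with halve n
... | k , inj₂ n≡ = k , n≡
... | k , inj₁ refl with () ← trans (sym (parity-double k)) odd

b4-lo : ∀ n → lo (b4 n) ≡ parity n
b4-lo n with halve n
... | k , inj₁ refl = trans (cong lo (b4-double k)) (trans (lo-fromBits 0ℙ _) (sym (parity-double k)))
... | k , inj₂ refl = trans (cong lo (b4-double+1 k)) (trans (lo-fromBits 1ℙ _) (sym (parity-double+1 k)))

b4-hi-double : ∀ k → hi (b4 (k + k)) ≡ parity k
b4-hi-double k = trans (cong hi (b4-double k)) (trans (hi-fromBits 0ℙ _) (b4-lo k))

b4-hi-double+1 : ∀ k → hi (b4 (suc (k + k))) ≡ hi (b4 k)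
b4-hi-double+1 k = trans (cong hi (b4-double+1 k)) (hi-fromBits 1ℙ _)

module _ {q} (c : Cycle b4 q) where
  open Cycle c

  parity-position : ∀ j → parity (position j) ≡ lo (word j)
  parity-position j = trans (sym (b4-lo (position j))) (cong lo (window₀ j))

  lo-word-+ : ∀ j {i} → i ≤ q → lo (word (j + i)) ≡ lo (word j) ⊕ parity i
  lo-word-+ j {i} i≤q = begin
    lo (word (j + i))               ≡⟨ cong lo (window j i i≤q) ⟨
    lo (b4 (position j + i))        ≡⟨ b4-lo (position j + i) ⟩
    parity (position j + i)         ≡⟨ Parity.+-homo-+ (position j) i ⟩
    parity (position j) ⊕ parity i  ≡⟨ cong (_⊕ parity i) (parity-position j) ⟩
    lo (word j) ⊕ parity i          ∎
    where open ≡-Reasoning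

  period-even : parity q ≡ 0ℙ
  period-even = Parity.+-cancelˡ-≡ (lo (word 0)) (parity q) 0ℙ (begin
    lo (word 0) ⊕ parity q  ≡⟨ lo-word-+ 0 ≤-refl ⟨
    lo (word q)             ≡⟨ cong lo (periodic 0) ⟩
    lo (word 0)             ≡⟨ Parity.+-identityʳ (lo (word 0)) ⟨
    lo (word 0) ⊕ 0ℙ        ∎)
    where open ≡-Reasoning

  normalise : 1 ≤ q → Σ (Cycle b4 q) λ c′ → lo (Cycle.word c′ 0) ≡ 0ℙ
  normalise 1≤q with lo (word 0) in lo₀
  ... | 0ℙ = c , lo₀
  ... | 1ℙ = shiftCycle 1 c , trans (lo-word-+ 0 1≤q) (cong (_⊕ 1ℙ) lo₀)

-- Once word n is read at positions of the parity of n, a cycle of period 2q₁ in b4 splits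
-- into σ-images σ(v k) = word (2k) word (2k+1), and v is a cycle of period q₁; since
-- σ(a) = (0, lo a)(1, hi a), v k is read off the hi bits.
module σ-Desubstitution {q₁′} (c : Cycle b4 (suc q₁′ + suc q₁′)) (lo-word₀ : lo (Cycle.word c 0) ≡ 0ℙ) where
  open Cycle c

  q₁ q : ℕ
  q₁ = suc q₁′
  q = q₁ + q₁

  lo-word : ∀ n → lo (word n) ≡ parity n
  lo-word zero = lo-word₀
  lo-word (suc n) = begin
    lo (word (suc n))  ≡⟨ cong (lo ∘ word) (+-comm 1 n) ⟩
    lo (word (n + 1))  ≡⟨ lo-word-+ c n (s≤s z≤n) ⟩
    lo (word n) ⊕ 1ℙ   ≡⟨ cong (_⊕ 1ℙ) (lo-word n) ⟩
    parity n ⊕ 1ℙ      ≡⟨ Parity.+-comm (parity n) 1ℙ ⟩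
    1ℙ ⊕ parity n      ≡⟨ Parity.+-homo-+ 1 n ⟨
    parity (suc n)     ∎
    where open ≡-Reasoning

  position-odd : ∀ k → ∃ λ n → position (suc (k + k)) ≡ suc (n + n)
  position-odd k = odd⇒double+1 (position (suc (k + k)))
    (trans (parity-position c (suc (k + k))) (trans (lo-word (suc (k + k))) (parity-double+1 k)))

  N : ℕ → ℕ
  N k = proj₁ (position-odd k)

  v : ℕ → Fin 4
  v k = fromBits (hi (word (k + k))) (hi (word (suc (k + k))))

  double-+ : ∀ m n → (m + n) + (m + n) ≡ (m + m) + (n + n)
  double-+ = solve-∀

  v-periodic : ∀ k → v (k + q₁) ≡ v k
  v-periodic k = cong₂ (λ a b → fromBits (hi a) (hi b))
    (trans (cong word (double-+ k q₁)) (periodic (k + k)))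
    (trans (cong (word ∘ suc) (double-+ k q₁)) (periodic (suc (k + k))))

  q₁-even : parity q₁ ≡ 0ℙ
  q₁-even with even⇒double (position 0) (trans (parity-position c 0) lo-word₀)
  ... | M , position₀ = Parity.+-cancelˡ-≡ (parity M) (parity q₁) 0ℙ (begin
    parity M ⊕ parity q₁           ≡⟨ Parity.+-homo-+ M q₁ ⟨
    parity (M + q₁)                ≡⟨ b4-hi-double (M + q₁) ⟨
    hi (b4 ((M + q₁) + (M + q₁)))  ≡⟨ cong (hi ∘ b4) (trans (double-+ M q₁) (cong (_+ q) (sym position₀))) ⟩
    hi (b4 (position 0 + q))       ≡⟨ cong hi (window 0 q ≤-refl) ⟩
    hi (word q)                    ≡⟨ cong hi (periodic 0) ⟩
    hi (word 0)                    ≡⟨ cong hi (window₀ 0) ⟨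
    hi (b4 (position 0))           ≡⟨ cong (hi ∘ b4) position₀ ⟩
    hi (b4 (M + M))                ≡⟨ b4-hi-double M ⟩
    parity M                       ≡⟨ Parity.+-identityʳ (parity M) ⟨
    parity M ⊕ 0ℙ                  ∎)
    where open ≡-Reasoning

  i+i≤q : ∀ {i} → i ≤ q₁ → i + i ≤ q
  i+i≤q i≤q₁ = +-mono-≤ i≤q₁ i≤q₁

  i+i<q : ∀ {i} → i < q₁ → i + i < q
  i+i<q {i} i<q₁ = ≤-trans (n≤1+n _) (subst (_≤ q) (cong suc (+-suc i i)) (i+i≤q i<q₁))

  hi-window : ∀ k {i} → i ≤ q₁ → hi (b4 (N k + i)) ≡ hi (v (k + i))
  hi-window k {i} i≤q₁ = begin
    hi (b4 (N k + i))                           ≡⟨ b4-hi-double+1 (N k + i) ⟨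
    hi (b4 (suc ((N k + i) + (N k + i))))       ≡⟨ cong (hi ∘ b4) (trans (cong suc (double-+ (N k) i)) (cong (_+ (i + i)) (sym (proj₂ (position-odd k))))) ⟩
    hi (b4 (position (suc (k + k)) + (i + i)))  ≡⟨ cong hi (window (suc (k + k)) (i + i) (i+i≤q i≤q₁)) ⟩
    hi (word (suc (k + k) + (i + i)))           ≡⟨ cong (hi ∘ word ∘ suc) (double-+ k i) ⟨
    hi (word (suc ((k + i) + (k + i))))         ≡⟨ hi-fromBits _ _ ⟨
    hi (v (k + i))                              ∎
    where open ≡-Reasoning

  lo-window-suc : ∀ k {i} → i < q₁ → lo (b4 (N k + suc i)) ≡ lo (v (k + suc i))
  lo-window-suc k {i} i<q₁ = begin
    lo (b4 (N k + suc i))                           ≡⟨ b4-lo (N k + suc i) ⟩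
    parity (N k + suc i)                            ≡⟨ b4-hi-double (N k + suc i) ⟨
    hi (b4 ((N k + suc i) + (N k + suc i)))         ≡⟨ cong (hi ∘ b4) (trans (shuffle (N k) i) (cong (_+ suc (i + i)) (sym (proj₂ (position-odd k))))) ⟩
    hi (b4 (position (suc (k + k)) + suc (i + i)))  ≡⟨ cong hi (window (suc (k + k)) (suc (i + i)) (i+i<q i<q₁)) ⟩
    hi (word (suc (k + k) + suc (i + i)))           ≡⟨ cong (hi ∘ word) (shuffle k i) ⟨
    hi (word ((k + suc i) + (k + suc i)))           ≡⟨ lo-fromBits _ _ ⟨
    lo (v (k + suc i))                              ∎
    where
    open ≡-Reasoning
    shuffle : ∀ m i → (m + suc i) + (m + suc i) ≡ suc (m + m) + suc (i + i)
    shuffle = solve-∀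

  -- The lo bit of v k is not inside the window; it is recovered from v (k + q₁) since q₁ is even.
  lo-window-zero : ∀ k → lo (b4 (N k + 0)) ≡ lo (v (k + 0))
  lo-window-zero k = begin
    lo (b4 (N k + 0))         ≡⟨ cong (lo ∘ b4) (+-identityʳ (N k)) ⟩
    lo (b4 (N k))             ≡⟨ b4-lo (N k) ⟩
    parity (N k)              ≡⟨ Parity.+-identityʳ (parity (N k)) ⟨
    parity (N k) ⊕ 0ℙ         ≡⟨ cong (parity (N k) ⊕_) q₁-even ⟨
    parity (N k) ⊕ parity q₁  ≡⟨ Parity.+-homo-+ (N k) q₁ ⟨
    parity (N k + q₁)         ≡⟨ b4-lo (N k + q₁) ⟨
    lo (b4 (N k + q₁))        ≡⟨ lo-window-suc k ≤-refl ⟩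
    lo (v (k + q₁))           ≡⟨ cong lo (trans (v-periodic k) (cong v (sym (+-identityʳ k)))) ⟩
    lo (v (k + 0))            ∎
    where open ≡-Reasoning

  cycle : Cycle b4 q₁
  cycle = record
    { word = v
    ; periodic = v-periodic
    ; position = N
    ; window = λ k i i≤q₁ → lo-hi-injective (lo-window k i i≤q₁) (hi-window k i≤q₁)
    }
    where
    lo-window : ∀ k i → i ≤ q₁ → lo (b4 (N k + i)) ≡ lo (v (k + i))
    lo-window k zero _ = lo-window-zero k
    lo-window k (suc i) i<q₁ = lo-window-suc k i<q₁

b4-noCycle : ∀ q → 1 ≤ q → ¬ Cycle b4 q
b4-noCycle = <-rec (λ q → 1 ≤ q → ¬ Cycle b4 q) step
  where
  step : ∀ q → (∀ {q₁} → q₁ < q → 1 ≤ q₁ → ¬ Cycle b4 q₁) → 1 ≤ q → ¬ Cycle b4 q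
  step q rec 1≤q c with normalise c 1≤q | even⇒double q (period-even c)
  ... | c′ , lo₀ | suc q₁′ , refl = rec (m<m+n (suc q₁′) (s≤s z≤n)) (s≤s z≤n) (σ-Desubstitution.cycle c′ lo₀)
  ... | _ | zero , refl with () ← 1≤q

-- Uniform images

module Synchronisation {S : Set} (x : Word∞ S) (L′ D : ℕ)
  (sync : ∀ a b → (∀ i → i < D → x (a + i) ≡ x (b + i)) → a % suc L′ ≡ b % suc L′) where

  L : ℕ
  L = suc L′

  %-cong-suc : ∀ {a b} → a % L ≡ b % L → suc a % L ≡ suc b % L
  %-cong-suc {a} {b} a≡b = begin
    (1 + a) % L          ≡⟨ %-distribˡ-+ 1 a L ⟩
    (1 % L + a % L) % L  ≡⟨ cong (λ r → (1 % L + r) % L) a≡b ⟩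
    (1 % L + b % L) % L  ≡⟨ %-distribˡ-+ 1 b L ⟨
    (1 + b) % L          ∎
    where open ≡-Reasoning

  module _ {p} (D≤p : D ≤ p) (c : Cycle x p) where
    open Cycle c

    position-suc : ∀ j → position (suc j) % L ≡ suc (position j) % L
    position-suc j = sync (position (suc j)) (suc (position j)) λ i i<D → begin
      x (position (suc j) + i)  ≡⟨ window (suc j) i (≤-trans (<⇒≤ i<D) D≤p) ⟩
      word (suc (j + i))        ≡⟨ cong word (+-suc j i) ⟨
      word (j + suc i)          ≡⟨ window j (suc i) (≤-trans i<D D≤p) ⟨
      x (position j + suc i)    ≡⟨ cong x (+-suc (position j) i) ⟩
      x (suc (position j) + i)  ∎
      where open ≡-Reasoning

    position-≡-mod : ∀ j → position j % L ≡ (position 0 + j) % L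
    position-≡-mod zero = cong (_% L) (sym (+-identityʳ (position 0)))
    position-≡-mod (suc j) = trans (position-suc j) (trans (%-cong-suc (position-≡-mod j)) (cong (_% L) (sym (+-suc (position 0) j))))

    -- Shifting by L′ · position 0 moves position 0 to L · position 0 ≡ 0 (mod L).
    aligned : Σ (Cycle x p) λ c′ → ∀ j → Cycle.position c′ j % L ≡ j % L
    aligned = shiftCycle (L′ * position 0) c , λ j → begin
      position (L′ * position 0 + j) % L        ≡⟨ position-≡-mod (L′ * position 0 + j) ⟩
      (position 0 + (L′ * position 0 + j)) % L  ≡⟨ cong (_% L) (+-assoc (position 0) (L′ * position 0) j) ⟨
      (L * position 0 + j) % L                  ≡⟨ %-remove-+ˡ j (m∣m*n (position 0)) ⟩
      j % L                                     ∎
      where open ≡-Reasoning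

    period-≡0-mod : p % L ≡ 0
    period-≡0-mod = begin
      p % L            ≡⟨ aligned-position p ⟨
      position′ p % L  ≡⟨ sync (position′ p) (position′ 0) same-window ⟩
      position′ 0 % L  ≡⟨ aligned-position 0 ⟩
      0                ∎
      where
      open ≡-Reasoning
      open Cycle (proj₁ aligned) renaming (position to position′; word to word′; window to window′; periodic to periodic′)
      aligned-position = proj₂ aligned
      same-window : ∀ i → i < D → x (position′ p + i) ≡ x (position′ 0 + i)
      same-window i i<D = begin
        x (position′ p + i)  ≡⟨ window′ p i (≤-trans (<⇒≤ i<D) D≤p) ⟩
        word′ (p + i)        ≡⟨ cong word′ (+-comm p i) ⟩
        word′ (i + p)        ≡⟨ periodic′ i ⟩
        word′ i              ≡⟨ window′ 0 i (≤-trans (<⇒≤ i<D) D≤p) ⟨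
        x (position′ 0 + i)  ∎

module UniformImage {A S : Set} {L′ : ℕ} (g : A → Vec S (suc L′)) where

  L : ℕ
  L = suc L′

  imageLetter : A → ℕ → S
  imageLetter a n = vlookup (g a) (n mod L)

  mod-≡ : ∀ a b → a % L ≡ b % L → a mod L ≡ b mod L
  mod-≡ a b a≡b = Fin.toℕ-injective (trans (Fin.toℕ-fromℕ< _) (trans a≡b (sym (Fin.toℕ-fromℕ< _))))

  image-block : ∀ (y : Word∞ A) h {s} → s < L → imageUniform g y (h * L + s) ≡ imageLetter (y h) s
  image-block y h {s} s<L = cong₂ (λ k r → vlookup (g (y k)) r) quotient (mod-≡ (h * L + s) s remainder)
    where
    quotient : (h * L + s) / L ≡ h
    quotient = begin
      (h * L + s) / L    ≡⟨ +-distrib-/-∣ˡ s (n∣m*n h) ⟩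
      h * L / L + s / L  ≡⟨ cong₂ _+_ (m*n/n≡m h L) (m<n⇒m/n≡0 s<L) ⟩
      h + 0              ≡⟨ +-identityʳ h ⟩
      h                  ∎
      where open ≡-Reasoning
    remainder : (h * L + s) % L ≡ s % L
    remainder = %-remove-+ˡ s (n∣m*n h)

  -- If the positions of a cycle of period (1 + q′)L in g(y) are aligned with the blocks,
  -- its word is g(v 0) g(v 1) ⋯ for a (1 + q′)-periodic v. The window at k L + r₀ contains
  -- the suffix of g(v k) from r₀ on, then g(v (k+1)) ⋯ g(v (k+q′)) and the prefix of
  -- g(v (k+1+q′)) up to r₀; recognising letters from these parts shows that
  -- v k ⋯ v (k+1+q′) occurs in y.
  module Desubstitution (y : Word∞ A) {r₀} (r₀<L : r₀ < L)
    (prefix-injective : ∀ {a b} → (∀ s → s ≤ r₀ → imageLetter a s ≡ imageLetter b s) → a ≡ b)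
    (suffix-injective : ∀ {a b} → (∀ t → r₀ + t < L → imageLetter a (r₀ + t) ≡ imageLetter b (r₀ + t)) → a ≡ b)
    {q′} (c : Cycle (imageUniform g y) (suc q′ * L)) (aligned : ∀ j → Cycle.position c j % L ≡ j % L) where

    open Cycle c

    x : Word∞ S
    x = imageUniform g y

    q p : ℕ
    q = suc q′
    p = q * L

    L≤p : L ≤ p
    L≤p = m≤m+n L (q′ * L)

    block-position : ℕ → ℕ
    block-position k = position (k * L) / L

    v : ℕ → A
    v k = y (block-position k)

    position-block : ∀ k → position (k * L) ≡ block-position k * L
    position-block k = begin
      position (k * L)                             ≡⟨ m≡m%n+[m/n]*n (position (k * L)) L ⟩
      position (k * L) % L + block-position k * L  ≡⟨ cong (_+ block-position k * L) (trans (aligned (k * L)) (m*n%n≡0 k L)) ⟩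
      block-position k * L                         ∎
      where open ≡-Reasoning

    word-block : ∀ k {s} → s < L → word (k * L + s) ≡ imageLetter (v k) s
    word-block k {s} s<L = begin
      word (k * L + s)              ≡⟨ window (k * L) s (≤-trans (<⇒≤ s<L) L≤p) ⟨
      x (position (k * L) + s)      ≡⟨ cong (λ n → x (n + s)) (position-block k) ⟩
      x (block-position k * L + s)  ≡⟨ image-block y (block-position k) s<L ⟩
      imageLetter (v k) s           ∎
      where open ≡-Reasoning

    v-periodic : ∀ k → v (k + q) ≡ v k
    v-periodic k = prefix-injective λ s s≤r₀ →
      let s<L = ≤-<-trans s≤r₀ r₀<L in begin
      imageLetter (v (k + q)) s   ≡⟨ word-block (k + q) s<L ⟨
      word ((k + q) * L + s)      ≡⟨ cong word (shift-period k q L s) ⟩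
      word ((k * L + s) + q * L)  ≡⟨ periodic (k * L + s) ⟩
      word (k * L + s)            ≡⟨ word-block k s<L ⟩
      imageLetter (v k) s         ∎
      where
      open ≡-Reasoning
      shift-period : ∀ k q L s → (k + q) * L + s ≡ (k * L + s) + q * L
      shift-period = solve-∀

    e : ℕ
    e = L ∸ r₀

    r₀+e≡L : r₀ + e ≡ L
    r₀+e≡L = m+[n∸m]≡n (<⇒≤ r₀<L)

    start : ℕ → ℕ
    start k = position (k * L + r₀) / L

    position-start : ∀ k → position (k * L + r₀) ≡ r₀ + start k * L
    position-start k = begin
      position (k * L + r₀)                    ≡⟨ m≡m%n+[m/n]*n (position (k * L + r₀)) L ⟩
      position (k * L + r₀) % L + start k * L  ≡⟨ cong (_+ start k * L) remainder ⟩
      r₀ + start k * L                         ∎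
      where
      open ≡-Reasoning
      remainder : position (k * L + r₀) % L ≡ r₀
      remainder = trans (aligned (k * L + r₀)) (trans (%-remove-+ˡ r₀ (n∣m*n k)) (m<n⇒m%n≡m r₀<L))

    window-zero : ∀ k → y (start k + 0) ≡ v (k + 0)
    window-zero k = trans (suffix-injective λ t r₀+t<L → begin
      imageLetter (y (start k + 0)) (r₀ + t)  ≡⟨ image-block y (start k + 0) r₀+t<L ⟨
      x ((start k + 0) * L + (r₀ + t))        ≡⟨ cong x (rearrange (start k) r₀ t L) ⟩
      x ((r₀ + start k * L) + t)              ≡⟨ cong (λ n → x (n + t)) (position-start k) ⟨
      x (position (k * L + r₀) + t)           ≡⟨ window (k * L + r₀) t (≤-trans (≤-trans (m≤n+m t r₀) (<⇒≤ r₀+t<L)) L≤p) ⟩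
      word ((k * L + r₀) + t)                 ≡⟨ cong word (+-assoc (k * L) r₀ t) ⟩
      word (k * L + (r₀ + t))                 ≡⟨ word-block k r₀+t<L ⟩
      imageLetter (v k) (r₀ + t)              ∎) (cong v (sym (+-identityʳ k)))
      where
      open ≡-Reasoning
      rearrange : ∀ n r t L → (n + 0) * L + (r + t) ≡ (r + n * L) + t
      rearrange = solve-∀

    offset : ℕ → ℕ → ℕ
    offset i s = e + (i * L + s)

    offset≤p : ∀ {i s} → suc i ≤ q → s ≤ r₀ → offset i s ≤ p
    offset≤p {i} {s} i<q s≤r₀ = begin
      e + (i * L + s)   ≡⟨ exchange e (i * L) s ⟩
      i * L + (e + s)   ≤⟨ +-monoʳ-≤ (i * L) (+-monoʳ-≤ e s≤r₀) ⟩
      i * L + (e + r₀)  ≡⟨ cong (i * L +_) (trans (+-comm e r₀) r₀+e≡L) ⟩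
      i * L + L         ≡⟨ +-comm (i * L) L ⟩
      suc i * L         ≤⟨ *-monoˡ-≤ L i<q ⟩
      p                 ∎
      where
      open ≤-Reasoning
      exchange : ∀ a b c → a + (b + c) ≡ b + (a + c)
      exchange = solve-∀

    reading-position : ∀ n i s → (n + suc i) * L + s ≡ (r₀ + n * L) + offset i s
    reading-position n i s = subst (λ L → (n + suc i) * L + s ≡ (r₀ + n * L) + (e + (i * L + s))) r₀+e≡L (identity n i r₀ e s)
      where
      identity : ∀ n i r e s → (n + suc i) * (r + e) + s ≡ (r + n * (r + e)) + (e + (i * (r + e) + s))
      identity = solve-∀

    word-position : ∀ k i s → (k * L + r₀) + offset i s ≡ (k + suc i) * L + s
    word-position k i s = subst (λ L → (k * L + r₀) + (e + (i * L + s)) ≡ (k + suc i) * L + s) r₀+e≡L (identity k i r₀ e s)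
      where
      identity : ∀ k i r e s → (k * (r + e) + r) + (e + (i * (r + e) + s)) ≡ (k + suc i) * (r + e) + s
      identity = solve-∀

    window-suc : ∀ k {i} → suc i ≤ q → y (start k + suc i) ≡ v (k + suc i)
    window-suc k {i} i<q = prefix-injective λ s s≤r₀ →
      let s<L = ≤-<-trans s≤r₀ r₀<L in begin
      imageLetter (y (start k + suc i)) s     ≡⟨ image-block y (start k + suc i) s<L ⟨
      x ((start k + suc i) * L + s)           ≡⟨ cong x (reading-position (start k) i s) ⟩
      x ((r₀ + start k * L) + offset i s)     ≡⟨ cong (λ n → x (n + offset i s)) (position-start k) ⟨
      x (position (k * L + r₀) + offset i s)  ≡⟨ window (k * L + r₀) (offset i s) (offset≤p i<q s≤r₀) ⟩
      word ((k * L + r₀) + offset i s)        ≡⟨ cong word (word-position k i s) ⟩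
      word ((k + suc i) * L + s)              ≡⟨ word-block (k + suc i) s<L ⟩
      imageLetter (v (k + suc i)) s           ∎
      where open ≡-Reasoning

    cycle : Cycle y q
    cycle = record
      { word = v
      ; periodic = v-periodic
      ; position = start
      ; window = λ { k zero _ → window-zero k ; k (suc i) i<q → window-suc k i<q }
      }

-- The images of b4 under g3 and g2

module ImageOfB4 {S : Set} (_≟_ : DecidableEquality S) {L′ : ℕ} (g : Fin 4 → Vec S (suc L′)) where
  open UniformImage g

  x : Word∞ S
  x = imageUniform g b4

  Adjacent : Fin 4 → Fin 4 → Set
  Adjacent a b = ¬ lo a ≡ lo b

  adjacent? : ∀ a b → Dec (Adjacent a b)
  adjacent? a b = ¬? (lo a Parity.≟ lo b)

  b4-adjacent : ∀ h → Adjacent (b4 h) (b4 (suc h))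
  b4-adjacent h lo≡ = Parity.p≢p⁻¹ (parity h) (begin
    parity h         ≡⟨ b4-lo h ⟨
    lo (b4 h)        ≡⟨ lo≡ ⟩
    lo (b4 (suc h))  ≡⟨ b4-lo (suc h) ⟩
    parity (suc h)   ≡⟨ Parity.+-homo-+ 1 h ⟩
    parity h ⁻¹      ∎)
    where open ≡-Reasoning

  read₂ : Fin L → Fin 4 → Fin 4 → ℕ → S
  read₂ r a b i with toℕ r + i <? L
  ... | yes _ = imageLetter a (toℕ r + i)
  ... | no _ = imageLetter b (toℕ r + i ∸ L)

  block-decomposition : ∀ n i → n + i ≡ n / L * L + (toℕ (n mod L) + i)
  block-decomposition n i = begin
    n + i                            ≡⟨ cong (_+ i) (m≡m%n+[m/n]*n n L) ⟩
    n % L + n / L * L + i            ≡⟨ cong (λ r → r + n / L * L + i) (Fin.toℕ-fromℕ< (m%n<n n L)) ⟨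
    toℕ (n mod L) + n / L * L + i    ≡⟨ cong (_+ i) (+-comm (toℕ (n mod L)) (n / L * L)) ⟩
    n / L * L + toℕ (n mod L) + i    ≡⟨ +-assoc (n / L * L) (toℕ (n mod L)) i ⟩
    n / L * L + (toℕ (n mod L) + i)  ∎
    where open ≡-Reasoning

  x-read₂ : ∀ n {i} → toℕ (n mod L) + i < L + L → x (n + i) ≡ read₂ (n mod L) (b4 (n / L)) (b4 (suc (n / L))) i
  x-read₂ n {i} fits with toℕ (n mod L) + i <? L
  ... | yes r+i<L = trans (cong x (block-decomposition n i)) (image-block b4 (n / L) r+i<L)
  ... | no r+i≮L = trans (cong x (trans (block-decomposition n i) next-block)) (image-block b4 (suc (n / L)) (+-cancelˡ-< L _ _ (subst (_< L + L) (sym L+rest≡) fits)))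
    where
    L+rest≡ : L + (toℕ (n mod L) + i ∸ L) ≡ toℕ (n mod L) + i
    L+rest≡ = m+[n∸m]≡n (≮⇒≥ r+i≮L)
    next-block : n / L * L + (toℕ (n mod L) + i) ≡ suc (n / L) * L + (toℕ (n mod L) + i ∸ L)
    next-block = begin
      n / L * L + (toℕ (n mod L) + i)            ≡⟨ cong (n / L * L +_) L+rest≡ ⟨
      n / L * L + (L + (toℕ (n mod L) + i ∸ L))  ≡⟨ +-assoc (n / L * L) L _ ⟨
      n / L * L + L + (toℕ (n mod L) + i ∸ L)    ≡⟨ cong (_+ (toℕ (n mod L) + i ∸ L)) (+-comm (n / L * L) L) ⟩
      suc (n / L) * L + (toℕ (n mod L) + i ∸ L)  ∎
      where open ≡-Reasoning

  read₂-fits : ∀ (r : Fin L) {i} → i ≤ L → toℕ r + i < L + L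
  read₂-fits r i≤L = +-mono-<-≤ (Fin.toℕ<n r) i≤L

  -- The finite conditions below range over all r and all pairs ab with Adjacent a b,
  -- a superset of the readings of factors of x of length at most L + 1.
  Synchronising : ℕ → Set
  Synchronising D = ∀ r r′ a b a′ b′ → Adjacent a b → Adjacent a′ b′ →
                    (∀ (i : Fin D) → read₂ r a b (toℕ i) ≡ read₂ r′ a′ b′ (toℕ i)) → r ≡ r′

  synchronising? : ∀ D → Dec (Synchronising D)
  synchronising? D = Fin.all? λ r → Fin.all? λ r′ → Fin.all? λ a → Fin.all? λ b → Fin.all? λ a′ → Fin.all? λ b′ →
    adjacent? a b →-dec adjacent? a′ b′ →-dec
    Fin.all? (λ i → read₂ r a b (toℕ i) ≟ read₂ r′ a′ b′ (toℕ i)) →-dec r Fin.≟ r′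

  PrefixInjective : ℕ → Set
  PrefixInjective r₀ = ∀ a b → (∀ (s : Fin (suc r₀)) → imageLetter a (toℕ s) ≡ imageLetter b (toℕ s)) → a ≡ b

  prefixInjective? : ∀ r₀ → Dec (PrefixInjective r₀)
  prefixInjective? r₀ = Fin.all? λ a → Fin.all? λ b →
    Fin.all? (λ s → imageLetter a (toℕ s) ≟ imageLetter b (toℕ s)) →-dec a Fin.≟ b

  SuffixInjective : ℕ → Set
  SuffixInjective r₀ = ∀ a b → (∀ (t : Fin (L ∸ r₀)) → imageLetter a (r₀ + toℕ t) ≡ imageLetter b (r₀ + toℕ t)) → a ≡ b

  suffixInjective? : ∀ r₀ → Dec (SuffixInjective r₀)
  suffixInjective? r₀ = Fin.all? λ a → Fin.all? λ b →
    Fin.all? (λ t → imageLetter a (r₀ + toℕ t) ≟ imageLetter b (r₀ + toℕ t)) →-dec a Fin.≟ b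

  -- The word of a cycle of period 1 + p′ ≤ L is determined by the reading (r, a, b) of its
  -- first window; the condition asks for a window of that word, starting at j, that is
  -- not readable at all.
  ShortPeriodExcluded : ℕ → Set
  ShortPeriodExcluded p′ = ∀ r a b → Adjacent a b → read₂ r a b 0 ≡ read₂ r a b (suc p′) →
    Σ (Fin (suc p′)) λ j → ∀ r′ a′ b′ → Adjacent a′ b′ →
      ¬ (∀ (i : Fin (2 + p′)) → read₂ r′ a′ b′ (toℕ i) ≡ read₂ r a b ((toℕ j + toℕ i) % suc p′))

  shortPeriodExcluded? : ∀ p′ → Dec (ShortPeriodExcluded p′)
  shortPeriodExcluded? p′ = Fin.all? λ r → Fin.all? λ a → Fin.all? λ b →
    adjacent? a b →-dec (read₂ r a b 0 ≟ read₂ r a b (suc p′)) →-dec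
    Fin.any? λ j → Fin.all? λ r′ → Fin.all? λ a′ → Fin.all? λ b′ → adjacent? a′ b′ →-dec
      ¬? (Fin.all? λ i → read₂ r′ a′ b′ (toℕ i) ≟ read₂ r a b ((toℕ j + toℕ i) % suc p′))

  synchronising⇒≡-mod : ∀ {D} → D ≤ suc L → Synchronising D →
                        ∀ a b → (∀ i → i < D → x (a + i) ≡ x (b + i)) → a % L ≡ b % L
  synchronising⇒≡-mod {D} D≤L+1 synchronising a b same = begin
    a % L          ≡⟨ Fin.toℕ-fromℕ< _ ⟨
    toℕ (a mod L)  ≡⟨ cong toℕ (synchronising (a mod L) (b mod L) _ _ _ _ (b4-adjacent (a / L)) (b4-adjacent (b / L)) same-reading) ⟩
    toℕ (b mod L)  ≡⟨ Fin.toℕ-fromℕ< _ ⟩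
    b % L          ∎
    where
    open ≡-Reasoning
    i≤L : ∀ (i : Fin D) → toℕ i ≤ L
    i≤L i = ≤-pred (≤-trans (Fin.toℕ<n i) D≤L+1)
    same-reading : ∀ (i : Fin D) → read₂ (a mod L) _ _ (toℕ i) ≡ read₂ (b mod L) _ _ (toℕ i)
    same-reading i = trans (sym (x-read₂ a (read₂-fits (a mod L) (i≤L i))))
                    (trans (same (toℕ i) (Fin.toℕ<n i)) (x-read₂ b (read₂-fits (b mod L) (i≤L i))))

  module _ {p′} (p≤L : suc p′ ≤ L) (c : Cycle x (suc p′)) where
    open Cycle c

    private
      p = suc p′
      r = position 0 mod L
      a = b4 (position 0 / L)
      b = b4 (suc (position 0 / L))

    first-window : ∀ {k} → k ≤ p → word k ≡ read₂ r a b k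
    first-window {k} k≤p = trans (sym (window 0 k k≤p)) (x-read₂ (position 0) (read₂-fits r (≤-trans k≤p p≤L)))

    word-reading : ∀ n → word n ≡ read₂ r a b (n % p)
    word-reading n = begin
      word n                    ≡⟨ cong word (m≡m%n+[m/n]*n n p) ⟩
      word (n % p + n / p * p)  ≡⟨ periodic* (n % p) (n / p) ⟩
      word (n % p)              ≡⟨ first-window (m%n≤n n p) ⟩
      read₂ r a b (n % p)       ∎
      where open ≡-Reasoning

    cycle⇒¬shortPeriodExcluded : ¬ ShortPeriodExcluded p′
    cycle⇒¬shortPeriodExcluded excluded with excluded r a b (b4-adjacent (position 0 / L)) first≡last
      where
      first≡last : read₂ r a b 0 ≡ read₂ r a b p
      first≡last = trans (sym (first-window z≤n)) (trans (sym (periodic 0)) (first-window ≤-refl))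
    ... | j , unreadable = unreadable (position (toℕ j) mod L) _ _ (b4-adjacent (position (toℕ j) / L)) λ i → begin
      read₂ (position (toℕ j) mod L) _ _ (toℕ i)  ≡⟨ x-read₂ (position (toℕ j)) (read₂-fits _ (≤-trans (≤-pred (Fin.toℕ<n i)) p≤L)) ⟨
      x (position (toℕ j) + toℕ i)                ≡⟨ window (toℕ j) (toℕ i) (≤-pred (Fin.toℕ<n i)) ⟩
      word (toℕ j + toℕ i)                        ≡⟨ word-reading (toℕ j + toℕ i) ⟩
      read₂ r a b ((toℕ j + toℕ i) % p)           ∎
      where open ≡-Reasoning

  prefixInjective⇒ : ∀ {r₀} → PrefixInjective r₀ →
                     ∀ {a b} → (∀ s → s ≤ r₀ → imageLetter a s ≡ imageLetter b s) → a ≡ b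
  prefixInjective⇒ injective {a} {b} same = injective a b λ s → same (toℕ s) (≤-pred (Fin.toℕ<n s))

  suffixInjective⇒ : ∀ {r₀} → r₀ < L → SuffixInjective r₀ →
                     ∀ {a b} → (∀ t → r₀ + t < L → imageLetter a (r₀ + t) ≡ imageLetter b (r₀ + t)) → a ≡ b
  suffixInjective⇒ {r₀} r₀<L injective {a} {b} same = injective a b λ t →
    same (toℕ t) (subst (r₀ + toℕ t <_) (m+[n∸m]≡n (<⇒≤ r₀<L)) (+-monoʳ-< r₀ (Fin.toℕ<n t)))

  multiple-of-L : ∀ {p} → 1 ≤ p → p % L ≡ 0 → ∃ λ q′ → p ≡ suc q′ * L
  multiple-of-L {p} 1≤p p%L≡0 with p / L | m≡m%n+[m/n]*n p L
  ... | zero | p≡0 with () ← ≤-trans 1≤p (≤-reflexive (trans p≡0 (cong (_+ 0) p%L≡0)))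
  ... | suc q′ | p≡ = q′ , trans p≡ (cong (_+ suc q′ * L) p%L≡0)

  longPeriod⇒noCycle : ∀ {D r₀} → D ≤ suc L → r₀ < L → Synchronising D → PrefixInjective r₀ → SuffixInjective r₀ →
                       ∀ {p} → 1 ≤ p → D ≤ p → ¬ Cycle x p
  longPeriod⇒noCycle {D} D≤L+1 r₀<L synchronising prefix suffix {p} 1≤p D≤p c
    with Synchronisation.aligned x L′ D ≡-mod D≤p c | multiple-of-L 1≤p (Synchronisation.period-≡0-mod x L′ D ≡-mod D≤p c)
    where
    ≡-mod = synchronising⇒≡-mod D≤L+1 synchronising
  ... | c′ , aligned | q′ , refl =
    b4-noCycle (suc q′) (s≤s z≤n)
      (Desubstitution.cycle b4 r₀<L (prefixInjective⇒ prefix) (suffixInjective⇒ r₀<L suffix) c′ aligned)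

  record Certificate (m D r₀ : ℕ) : Set where
    field
      1≤m : 1 ≤ m
      D≤L+1 : D ≤ suc L
      r₀<L : r₀ < L
      synchronising : Synchronising D
      prefix-injective : PrefixInjective r₀
      suffix-injective : SuffixInjective r₀
      short-periods : All (ShortPeriodExcluded ∘ pred) (applyUpTo (m +_) (D ∸ m))

  noCycle : ∀ {m D r₀} → Certificate m D r₀ → ∀ {p} → m ≤ p → ¬ Cycle x p
  noCycle certificate {zero} m≤0 with () ← ≤-trans (Certificate.1≤m certificate) m≤0
  noCycle {m} {D} certificate {suc p′} m≤p with suc p′ <? D
  ... | no p≮D = longPeriod⇒noCycle D≤L+1 r₀<L synchronising prefix-injective suffix-injective (≤-trans 1≤m m≤p) (≮⇒≥ p≮D)
    where open Certificate certificate
  ... | yes p<D = λ c → cycle⇒¬shortPeriodExcluded (≤-pred (≤-trans p<D D≤L+1)) c excluded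
    where
    open Certificate certificate
    excluded : ShortPeriodExcluded p′
    excluded = subst (ShortPeriodExcluded ∘ pred) (m+[n∸m]≡n m≤p)
                     (applyUpTo⁻ (m +_) (D ∸ m) short-periods (∸-monoˡ-< p<D m≤p))

module G3 = ImageOfB4 Fin._≟_ g3
module G2 = ImageOfB4 Fin._≟_ g2

g3-certificate : G3.Certificate 3 5 2
g3-certificate = record
  { 1≤m = s≤s z≤n
  ; D≤L+1 = from-yes (5 ≤? 5)
  ; r₀<L = from-yes (2 <? 4)
  ; synchronising = from-yes (G3.synchronising? 5)
  ; prefix-injective = from-yes (G3.prefixInjective? 2)
  ; suffix-injective = from-yes (G3.suffixInjective? 2)
  ; short-periods = from-yes (G3.shortPeriodExcluded? 2) ∷ from-yes (G3.shortPeriodExcluded? 3) ∷ []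
  }

g2-certificate : G2.Certificate 4 14 5
g2-certificate = record
  { 1≤m = s≤s z≤n
  ; D≤L+1 = from-yes (14 ≤? 20)
  ; r₀<L = from-yes (5 <? 19)
  ; synchronising = from-yes (G2.synchronising? 14)
  ; prefix-injective = from-yes (G2.prefixInjective? 5)
  ; suffix-injective = from-yes (G2.suffixInjective? 5)
  ; short-periods =
      from-yes (G2.shortPeriodExcluded? 3) ∷ from-yes (G2.shortPeriodExcluded? 4) ∷
      from-yes (G2.shortPeriodExcluded? 5) ∷ from-yes (G2.shortPeriodExcluded? 6) ∷
      from-yes (G2.shortPeriodExcluded? 7) ∷ from-yes (G2.shortPeriodExcluded? 8) ∷
      from-yes (G2.shortPeriodExcluded? 9) ∷ from-yes (G2.shortPeriodExcluded? 10) ∷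
      from-yes (G2.shortPeriodExcluded? 11) ∷ from-yes (G2.shortPeriodExcluded? 12) ∷ []
  }

corollary1 : ((n : ℕ) → Avoids (imageUniform g3 b4) (C (3 + n)))
           × ((n : ℕ) → Avoids (imageUniform g2 b4) (C (4 + n)))
corollary1 = avoids-g3 , avoids-g2
  where
  avoids-g3 : (n : ℕ) → Avoids (imageUniform g3 b4) (C (3 + n))
  avoids-g3 n occurrence with occurs-C⇒Cycle (2 + n) occurrence
  ... | _ , t≤p , c = G3.noCycle g3-certificate (≤-trans (m≤m+n 3 n) t≤p) c
  avoids-g2 : (n : ℕ) → Avoids (imageUniform g2 b4) (C (4 + n))
  avoids-g2 n occurrence with occurs-C⇒Cycle (3 + n) occurrence
  ... | _ , t≤p , c = G2.noCycle g2-certificate (≤-trans (m≤m+n 4 n) t≤p) c
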